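{- Let $\hat b,\hat g,\hat f_1,\hat f_2\in\mathbb{R}[[t]]$ with $\hat b(0),\hat g(0)\ne0$ and $\hat f_1,\hat f_2$ of order $1$. If the compressed double almost-Riordan array $(\hat b|\hat g;\hat f_1,\hat f_2)$ is totally positive, then the compressed double Riordan array $(\hat g;\hat f_1,\hat f_2)$ is totally positive.
   Context: The compressed double almost-Riordan array $(\hat b|\hat g;\hat f_1,\hat f_2)$ is the infinite lower triangular matrix whose $k$-th column has generating function $\hat b$ for $k=0$, $t\hat g(\hat f_1\hat f_2)^{\ell}$ for $k=2\ell+1$, and $t\hat g\hat f_1(\hat f_1\hat f_2)^{\ell}$ for $k=2\ell+2$. The compressed double Riordan array $(\hat g;\hat f_1,\hat f_2)$ is the infinite lower triangular matrix whose $k$-th column has generating function $\hat g(\hat f_1\hat f_2)^{\ell}$ for $k=2\ell$ and $\hat g\hat f_1(\hat f_1\hat f_2)^{\ell}$ for $k=2\ell+1$. A matrix is totally positive if all its minors are nonnegative. -}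

module Defs where

open import Level using (Level; _⊔_) renaming (suc to lsuc)
open import Data.Nat as ℕ using (ℕ; zero; suc)
open import Data.Fin using (Fin; zero; suc; punchIn; _<_; toℕ)
open import Data.Bool using (Bool; true; false; if_then_else_)
open import Data.Product using (Σ; _×_; _,_)
open import Relation.Nullary using (¬_)
open import Relation.Binary.Core using (Rel)
open import Relation.Binary.Structures using (IsTotalOrder)
open import Algebra.Bundles using (CommutativeRing)

-- An ordered field (the paper works over ℝ; the standard library has
-- no reals, so we quantify over an arbitrary ordered field, of which ℝ
-- is an instance).

record OrderedField (c ℓ₁ ℓ₂ : Level) : Set (lsuc (c ⊔ ℓ₁ ⊔ ℓ₂)) where
  field
    commutativeRing : CommutativeRing c ℓ₁
  open CommutativeRing commutativeRing public
  field
    _≤_          : Rel Carrier ℓ₂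
    isTotalOrder : IsTotalOrder _≈_ _≤_
    0≉1          : ¬ (0# ≈ 1#)
    inverse      : ∀ x → ¬ (x ≈ 0#) → Σ Carrier λ y → (x * y) ≈ 1#
    +-mono-≤     : ∀ {x y} z → x ≤ y → (x + z) ≤ (y + z)
    *-nonneg     : ∀ {x y} → 0# ≤ x → 0# ≤ y → 0# ≤ (x * y)

module Series {c ℓ₁ ℓ₂} (F : OrderedField c ℓ₁ ℓ₂) where
  open OrderedField F hiding (zero)

  PS : Set c
  PS = ℕ → Carrier

  sumTo : ℕ → (ℕ → Carrier) → Carrier
  sumTo zero    f = f 0
  sumTo (suc n) f = sumTo n f + f (suc n)

  _·_ : PS → PS → PS
  (a · b) n = sumTo n (λ i → a i * b (n ℕ.∸ i))

  one : PS
  one zero    = 1#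
  one (suc _) = 0#

  _^^_ : PS → ℕ → PS
  a ^^ zero  = one
  a ^^ suc k = a · (a ^^ k)

  tx : PS → PS
  tx a zero    = 0#
  tx a (suc n) = a n

  Order1 : PS → Set ℓ₁
  Order1 f = (f 0 ≈ 0#) × ¬ (f 1 ≈ 0#)

  Matrix : Set c
  Matrix = ℕ → ℕ → Carrier

  -- coefficient matrix of an array given by its column generating functions:
  -- entry (n , k) = [t^n] (column k)
  arrayOf : (ℕ → PS) → Matrix
  arrayOf col n k = col k n

  half : ℕ → ℕ
  half zero          = zero
  half (suc zero)    = zero
  half (suc (suc k)) = suc (half k)

  even : ℕ → Bool
  even zero          = true
  even (suc zero)    = false
  even (suc (suc k)) = even k

  -- compressed double Riordan array (g ; f₁ , f₂):
  -- column 2ℓ has g.f. g (f₁f₂)^ℓ, column 2ℓ+1 has g.f. g f₁ (f₁f₂)^ℓ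
  cdrCol : PS → PS → PS → ℕ → PS
  cdrCol g f₁ f₂ k =
    if even k then g · ((f₁ · f₂) ^^ half k)
              else (g · f₁) · ((f₁ · f₂) ^^ half k)

  compressedDoubleRiordan : PS → PS → PS → Matrix
  compressedDoubleRiordan g f₁ f₂ = arrayOf (cdrCol g f₁ f₂)

  -- compressed double almost-Riordan array (b | g ; f₁ , f₂):
  -- column 0 has g.f. b, column 2ℓ+1 has t g (f₁f₂)^ℓ,
  -- column 2ℓ+2 has t g f₁ (f₁f₂)^ℓ
  cdarCol : PS → PS → PS → PS → ℕ → PS
  cdarCol b g f₁ f₂ zero    = b
  cdarCol b g f₁ f₂ (suc k) =
    if even k then tx (g · ((f₁ · f₂) ^^ half k))
              else tx ((g · f₁) · ((f₁ · f₂) ^^ half k))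

  compressedDoubleAlmostRiordan : PS → PS → PS → PS → Matrix
  compressedDoubleAlmostRiordan b g f₁ f₂ = arrayOf (cdarCol b g f₁ f₂)

  sumFin : ∀ n → (Fin n → Carrier) → Carrier
  sumFin zero    f = 0#
  sumFin (suc n) f = f zero + sumFin n (λ i → f (suc i))

  altSign : ℕ → Carrier
  altSign zero    = 1#
  altSign (suc k) = - altSign k

  det : ∀ n → (Fin n → Fin n → Carrier) → Carrier
  det zero    M = 1#
  det (suc n) M =
    sumFin (suc n) λ j →
      (altSign (toℕ j) * M zero j) * det n (λ i j′ → M (suc i) (punchIn j j′))

  StrictlyIncreasing : ∀ {n} → (Fin n → ℕ) → Set
  StrictlyIncreasing {n} r = ∀ (i j : Fin n) → i < j → r i ℕ.< r j

  TotallyPositive : Matrix → Set ℓ₂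
  TotallyPositive M =
    ∀ (n : ℕ) (rows cols : Fin n → ℕ) →
      StrictlyIncreasing rows → StrictlyIncreasing cols →
      0# ≤ det n (λ i j → M (rows i) (cols j))

-- Deleting the first row and column of the compressed double almost-Riordan
-- array (b | g ; f₁ , f₂) leaves exactly the compressed double Riordan array
-- (g ; f₁ , f₂), since column k+1 of the former is t times column k of the
-- latter. Every minor of a submatrix is a minor of the whole matrix, so total
-- positivity is inherited.
module Submission where

open import Defs
open import Relation.Nullary using (¬_)
open import Data.Nat as ℕ using (ℕ; zero; suc; s≤s)
open import Data.Fin using (Fin; zero; suc; punchIn; toℕ)
open import Data.Bool using (true; false)
open import Relation.Binary.PropositionalEquality using (_≡_; refl; cong; cong₂; subst)

module TotalPositivity {c ℓ₁ ℓ₂} (F : OrderedField c ℓ₁ ℓ₂) where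
  open OrderedField F using (Carrier; _*_; _+_; _≤_; 0#)
  open Series F

  sumFin-cong : ∀ n {f h : Fin n → Carrier} → (∀ i → f i ≡ h i) →
                sumFin n f ≡ sumFin n h
  sumFin-cong zero    f≡h = refl
  sumFin-cong (suc n) f≡h = cong₂ _+_ (f≡h zero) (sumFin-cong n (λ i → f≡h (suc i)))

  det-cong : ∀ n {M N : Fin n → Fin n → Carrier} → (∀ i j → M i j ≡ N i j) →
             det n M ≡ det n N
  det-cong zero    M≡N = refl
  det-cong (suc n) M≡N = sumFin-cong (suc n) λ j →
    cong₂ _*_ (cong (altSign (toℕ j) *_) (M≡N zero j))
              (det-cong n (λ i j′ → M≡N (suc i) (punchIn j j′)))

  StrictlyMonotone : (ℕ → ℕ) → Set
  StrictlyMonotone ρ = ∀ {m n} → m ℕ.< n → ρ m ℕ.< ρ n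

  TotallyPositive-submatrix : ∀ {M : Matrix} {ρ σ : ℕ → ℕ} →
    StrictlyMonotone ρ → StrictlyMonotone σ →
    TotallyPositive M → TotallyPositive (λ n k → M (ρ n) (σ k))
  TotallyPositive-submatrix {ρ = ρ} {σ} ρ-mono σ-mono tp n rows cols rows↑ cols↑ =
    tp n (λ i → ρ (rows i)) (λ j → σ (cols j))
       (λ i j i<j → ρ-mono (rows↑ i j i<j)) (λ i j i<j → σ-mono (cols↑ i j i<j))

  TotallyPositive-resp-≡ : ∀ {M N : Matrix} → (∀ n k → M n k ≡ N n k) →
    TotallyPositive M → TotallyPositive N
  TotallyPositive-resp-≡ M≡N tp n rows cols rows↑ cols↑ =
    subst (0# ≤_) (det-cong n (λ i j → M≡N (rows i) (cols j)))
          (tp n rows cols rows↑ cols↑)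

  almostRiordan-suc-suc : ∀ b g f₁ f₂ n k →
    compressedDoubleAlmostRiordan b g f₁ f₂ (suc n) (suc k) ≡
    compressedDoubleRiordan g f₁ f₂ n k
  almostRiordan-suc-suc b g f₁ f₂ n k with even k
  ... | true  = refl
  ... | false = refl

proposition5p2 : ∀ {c ℓ₁ ℓ₂} (F : OrderedField c ℓ₁ ℓ₂) →
    let open OrderedField F
        open Series F
    in (b g f₁ f₂ : PS) →
       ¬ (b 0 ≈ 0#) → ¬ (g 0 ≈ 0#) → Order1 f₁ → Order1 f₂ →
       TotallyPositive (compressedDoubleAlmostRiordan b g f₁ f₂) →
       TotallyPositive (compressedDoubleRiordan g f₁ f₂)
proposition5p2 F b g f₁ f₂ _ _ _ _ tp =
  TotallyPositive-resp-≡ (almostRiordan-suc-suc b g f₁ f₂)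
    (TotallyPositive-submatrix {compressedDoubleAlmostRiordan b g f₁ f₂} {suc} {suc}
       s≤s s≤s tp)
  where open TotalPositivity F
        open Series F
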